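{- Let $G$ be a connected graph and $H$ a connected subgraph of $G$. Then $\mathrm{Var}_G(H)\le \mathrm{diam}(H)+1$.
   Context: For a vertex $v$ of $G$, let $D_v(H)=\{d\in\mathbb{N} : \exists x\in V(H) \text{ with } d_G(v,x)=d\}$ be the set of distances in $G$ from $v$ to vertices of $H$. The distance variance of $H$ in $G$ is $\mathrm{Var}_G(H)=\max_{v\in V(G)}|D_v(H)|$. -}

module Defs where

open import Data.Nat using (ℕ; zero; suc; _≤_)
open import Data.Fin using (Fin)
open import Data.Bool using (Bool; true; false)
open import Data.Product using (Σ; ∃; _×_; _,_)
open import Data.List using (List; length)
open import Data.List.Relation.Unary.All using (All)
open import Data.List.Relation.Unary.Unique.Propositional using (Unique)
open import Relation.Binary.PropositionalEquality using (_≡_)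

record Graph (n : ℕ) : Set where
  field
    adj    : Fin n → Fin n → Bool
    sym    : ∀ u v → adj u v ≡ true → adj v u ≡ true
    irrefl : ∀ u → adj u u ≡ false
open Graph public

data Walk {n : ℕ} (A : Fin n → Fin n → Bool) : Fin n → Fin n → ℕ → Set where
  here : ∀ {u} → Walk A u u zero
  step : ∀ {u w v k} → A u w ≡ true → Walk A w v k → Walk A u v (suc k)

IsDist : {n : ℕ} → (Fin n → Fin n → Bool) → Fin n → Fin n → ℕ → Set
IsDist A u v d = Walk A u v d × (∀ k → Walk A u v k → d ≤ k)

Connected : {n : ℕ} → Graph n → Set
Connected G = ∀ u v → ∃ λ k → Walk (adj G) u v k

record SubGraph {n : ℕ} (G : Graph n) : Set where
  field
    inV     : Fin n → Bool
    adjH    : Fin n → Fin n → Bool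
    symH    : ∀ u v → adjH u v ≡ true → adjH v u ≡ true
    edge-sub : ∀ u v → adjH u v ≡ true →
               (adj G u v ≡ true) × (inV u ≡ true) × (inV v ≡ true)
open SubGraph public

ConnectedSub : {n : ℕ} {G : Graph n} → SubGraph G → Set
ConnectedSub H = ∀ u v → inV H u ≡ true → inV H v ≡ true →
                 ∃ λ k → Walk (adjH H) u v k

IsDiam : {n : ℕ} {G : Graph n} → SubGraph G → ℕ → Set
IsDiam H D =
  (Σ _ λ u → Σ _ λ v → inV H u ≡ true × inV H v ≡ true × IsDist (adjH H) u v D)
  × (∀ u v d → inV H u ≡ true → inV H v ≡ true → IsDist (adjH H) u v d → d ≤ D)

-- d ∈ D_v(H): some vertex x of H has d_G(v,x) = d.
InDistSet : {n : ℕ} (G : Graph n) → SubGraph G → Fin n → ℕ → Set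
InDistSet G H v d = ∃ λ x → inV H x ≡ true × IsDist (adj G) v x d

-- |D_v(H)| ≤ k  (D_v(H) is a set of naturals; every duplicate-free list of its
-- elements has length ≤ k).
DistSetCardLe : {n : ℕ} (G : Graph n) → SubGraph G → Fin n → ℕ → Set
DistSetCardLe G H v k =
  ∀ (ds : List ℕ) → Unique ds → All (InDistSet G H v) ds → length ds ≤ k

-- Var_G(H) ≤ k  ⇔  |D_v(H)| ≤ k for every v ∈ V(G).
VarLe : {n : ℕ} (G : Graph n) → SubGraph G → ℕ → Set
VarLe G H k = ∀ v → DistSetCardLe G H v k

module Submission where

-- Fix a vertex v and a duplicate-free list ds of distances from v to
-- vertices of H.  If ds is empty there is nothing to show.  Otherwise let
-- m be its minimum, realised by a vertex x₀ of H with d_G(v,x₀) = m.  For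
-- any other x ∈ V(H) at distance d from v, a shortest walk x₀ → x inside H
-- has length at most D = diam(H); prefixing a shortest G-walk v → x₀
-- yields a G-walk v → x of length ≤ m + D, so d ≤ m + D.  Hence every
-- entry of ds lies in the window [m, m + D], which holds at most D + 1
-- distinct naturals.

open import Defs hiding (sym)
open import Data.Nat using (ℕ; zero; suc; _+_; _≤_; _<_; z≤n; s≤s)
open import Data.Nat.Properties
  using (≮⇒≥; anyUpTo?; +-monoʳ-≤; ≤-trans; ∸-cancelʳ-≡; m≤n+o⇒m∸n≤o)
open import Data.Nat.Induction using (<-rec)
open import Data.Fin using (Fin; toℕ; fromℕ<) renaming (zero to fzero; suc to fsuc)
open import Data.Fin.Properties using (any?; injective⇒≤; toℕ-fromℕ<) renaming (_≟_ to _≟ᶠ_)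
open import Data.Bool using (Bool; true)
open import Data.Bool.Properties using () renaming (_≟_ to _≟ᵇ_)
open import Data.Product using (∃; _×_; _,_; proj₁; proj₂)
open import Data.List using (List; []; _∷_; length; lookup)
open import Data.List.Extrema.Nat using (min; argmin-all; min≤⊤; min≤xs)
open import Data.List.Membership.Propositional.Properties using (∈-lookup)
open import Data.List.Relation.Unary.All as All using (All; []; _∷_)
open import Data.List.Relation.Unary.AllPairs using (_∷_)
open import Data.List.Relation.Unary.Unique.Propositional using (Unique)
open import Data.Empty using (⊥-elim)
open import Function using (id; _∘_; Injective)
open import Relation.Binary.PropositionalEquality using (_≡_; refl; sym; trans; cong)
open import Relation.Nullary using (Dec; yes; no)
open import Relation.Nullary.Decidable using (_×-dec_)

Least : (ℕ → Set) → Set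
Least P = ∃ λ j → P j × (∀ i → P i → j ≤ i)

least : ∀ {P : ℕ → Set} → (∀ k → Dec (P k)) → ∀ k → P k → Least P
least {P} P? = <-rec (λ k → P k → Least P) search
  where
  search : ∀ k → (∀ {n} → n < k → P n → Least P) → P k → Least P
  search k smaller pk with anyUpTo? P? k
  ... | yes (n , n<k , pn) = smaller n<k pn
  ... | no none = k , pk , λ i pi → ≮⇒≥ (λ i<k → none (i , i<k , pi))

module _ {n : ℕ} where

  _++ʷ_ : ∀ {A : Fin n → Fin n → Bool} {u w v j k} →
          Walk A u w j → Walk A w v k → Walk A u v (j + k)
  here     ++ʷ q = q
  step e p ++ʷ q = step e (p ++ʷ q)

  mapWalk : ∀ {A B : Fin n → Fin n → Bool} →
            (∀ u v → A u v ≡ true → B u v ≡ true) →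
            ∀ {u v k} → Walk A u v k → Walk B u v k
  mapWalk A⊆B here       = here
  mapWalk A⊆B (step e p) = step (A⊆B _ _ e) (mapWalk A⊆B p)

  walk? : (A : Fin n → Fin n → Bool) → ∀ k u v → Dec (Walk A u v k)
  walk? A zero u v with u ≟ᶠ v
  ... | yes refl = yes here
  ... | no u≢v   = no λ { here → u≢v refl }
  walk? A (suc k) u v with any? (λ w → (A u w ≟ᵇ true) ×-dec walk? A k w v)
  ... | yes (w , e , p) = yes (step e p)
  ... | no none         = no λ { (step e p) → none (_ , e , p) }

  -- Any two vertices joined by a walk have a distance: IsDist is exactly
  -- "least length of a walk", so this is the least-number principle.
  distance : (A : Fin n → Fin n → Bool) → ∀ {u v k} → Walk A u v k →
             ∃ λ d → IsDist A u v d
  distance A {u} {v} {k} w = least (λ j → walk? A j u v) k w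

lookup-injective : ∀ {A : Set} {xs : List A} → Unique xs →
                   Injective _≡_ _≡_ (lookup xs)
lookup-injective {xs = _ ∷ _}  _              {fzero}  {fzero}  _  = refl
lookup-injective {xs = _ ∷ _}  (x∉xs ∷ _)     {fzero}  {fsuc j} eq =
  ⊥-elim (All.lookup x∉xs (∈-lookup j) eq)
lookup-injective {xs = _ ∷ _}  (x∉xs ∷ _)     {fsuc i} {fzero}  eq =
  ⊥-elim (All.lookup x∉xs (∈-lookup i) (sym eq))
lookup-injective {xs = _ ∷ _}  (_ ∷ uniq)     {fsuc i} {fsuc j} eq =
  cong fsuc (lookup-injective uniq eq)

-- A duplicate-free list of naturals inside the window [m, m + w] has at most
-- w + 1 entries: shifting by m injects its positions into Fin (suc w).
unique-window-length : ∀ {m w} {ds : List ℕ} → Unique ds →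
                       All (λ d → m ≤ d × d ≤ m + w) ds → length ds ≤ suc w
unique-window-length {m} {w} {ds} uniq window = injective⇒≤ offset-injective
  where
  inWindow : ∀ i → m ≤ lookup ds i × lookup ds i ≤ m + w
  inWindow i = All.lookup window (∈-lookup i)

  offset : Fin (length ds) → Fin (suc w)
  offset i = fromℕ< (s≤s (m≤n+o⇒m∸n≤o (lookup ds i) m (proj₂ (inWindow i))))

  offset-injective : Injective _≡_ _≡_ offset
  offset-injective {i} {j} eq = lookup-injective uniq
    (∸-cancelʳ-≡ (proj₁ (inWindow i)) (proj₁ (inWindow j))
      (trans (sym (toℕ-fromℕ< _)) (trans (cong toℕ eq) (toℕ-fromℕ< _))))

-- The key estimate: if x₀ ∈ V(H) has d_G(v,x₀) = m, then every distance
-- from v to a vertex of H is at most m + diam(H), by the triangle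
-- inequality through x₀ along a shortest H-walk x₀ → x.
distance-bound : ∀ {n} {G : Graph n} (H : SubGraph G) → ConnectedSub H →
                 ∀ {D} → IsDiam H D →
                 ∀ {v x₀ m} → inV H x₀ ≡ true → IsDist (adj G) v x₀ m →
                 ∀ {d} → InDistSet G H v d → d ≤ m + D
distance-bound {G = G} H connH (_ , diam-max) {x₀ = x₀} {m} x₀∈H (walk-v-x₀ , _)
               {d} (x , x∈H , (_ , d-least))
  with distance (adjH H) (proj₂ (connH x₀ x x₀∈H x∈H))
... | dH , distH@(walk-x₀-x , _) =
  ≤-trans (d-least (m + dH) (walk-v-x₀ ++ʷ mapWalk H⊆G walk-x₀-x))
          (+-monoʳ-≤ m (diam-max x₀ x dH x₀∈H x∈H distH))
  where
  H⊆G : ∀ u u′ → adjH H u u′ ≡ true → adj G u u′ ≡ true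
  H⊆G u u′ = proj₁ ∘ edge-sub H u u′

lemma4p4 : ∀ {n : ℕ} (G : Graph n) (H : SubGraph G) →
    Connected G → ConnectedSub H →
    ∀ (D : ℕ) → IsDiam H D → VarLe G H (suc D)
lemma4p4 G H _ connH D diam v []           _    _    = z≤n
lemma4p4 G H _ connH D diam v (d₀ ∷ rest) uniq dists =
  unique-window-length uniq (All.zipWith inWindow (above-min , dists))
  where
  m : ℕ
  m = min d₀ rest

  m-realised : InDistSet G H v m
  m-realised = argmin-all id (All.head dists) (All.tail dists)

  above-min : All (m ≤_) (d₀ ∷ rest)
  above-min = min≤⊤ d₀ rest ∷ min≤xs d₀ rest

  inWindow : ∀ {d} → m ≤ d × InDistSet G H v d → m ≤ d × d ≤ m + D
  inWindow (m≤d , d∈) with m-realised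
  ... | x₀ , x₀∈H , dist-x₀ = m≤d , distance-bound H connH diam x₀∈H dist-x₀ d∈
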